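{- Let $n$ be a positive integer and $k$ a real number with $n\ge k\ge 2$. For every graph $G$ with $n$ vertices and minimum degree $\delta(G)\ge n/k+k$, there exist an integer $s<k$ and a set of vertices $U\subset V(G)$ with $|U|\le s-1$ such that $G-U$ is a union of $s$ vertex-disjoint $2$-connected graphs (i.e. $G-U$ has exactly $s$ connected components, each of which is $2$-connected).
   Context: $G-U$ denotes the subgraph of $G$ induced by $V(G)\setminus U$.
   Formalization: The parameter k ranges over the rationals rather than the reals. -}

module Defs where

open import Data.Nat as ℕ using (ℕ; suc)
open import Data.Bool using (Bool; true; false; if_then_else_)
open import Data.Fin using (Fin)
open import Data.Fin.Subset using (Subset; _∈_; _∉_; ∣_∣; _∩_; _∪_; ∁; ⁅_⁆; ⊥; ⊤; Nonempty)
open import Data.List using (List; map; allFin)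
open import Data.Nat.ListAction using (sum)
open import Data.Product using (_×_; ∃)
open import Relation.Binary.PropositionalEquality using (_≡_; _≢_)
open import Relation.Nullary using (¬_)
open import Data.Rational as ℚ using (ℚ; 0ℚ; _÷_; _<_; _≤_; >-nonZero)
open import Data.Rational.Properties using (<-≤-trans)
open import Data.Integer using (+_)

record Graph (n : ℕ) : Set where
  field
    adj   : Fin n → Fin n → Bool
    sym   : ∀ u v → adj u v ≡ adj v u
    irrefl : ∀ v → adj v v ≡ false
open Graph public

deg : ∀ {n} → Graph n → Fin n → ℕ
deg {n} G v = sum (map (λ w → if adj G v w then 1 else 0) (allFin n))

ℕ→ℚ : ℕ → ℚ
ℕ→ℚ m = (+ m) ℚ./ 1

_/ₖ_⟨_⟩ : ℚ → (k : ℚ) → ℕ→ℚ 2 ≤ k → ℚ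
p /ₖ k ⟨ h ⟩ = _÷_ p k {{>-nonZero (<-≤-trans (ℚ.*<* (Data.Integer.+<+ (ℕ.s≤s ℕ.z≤n))) h)}}

data Walk {n} (G : Graph n) (W : Subset n) : Fin n → Fin n → Set where
  here : ∀ {v} → v ∈ W → Walk G W v v
  step : ∀ {u w v} → u ∈ W → adj G u w ≡ true → Walk G W w v → Walk G W u v

Connected : ∀ {n} → Graph n → Subset n → Set
Connected G W = Nonempty W × (∀ u v → u ∈ W → v ∈ W → Walk G W u v)

TwoConnected : ∀ {n} → Graph n → Subset n → Set
TwoConnected G W =
  (3 ℕ.≤ ∣ W ∣) × Connected G W × (∀ x → x ∈ W → Connected G (W ∩ ∁ ⁅ x ⁆))

-- G - U is the union of s vertex-disjoint 2-connected graphs: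
-- its vertex set V(G)∖U is partitioned into W₁,…,Wₛ, each G[Wᵢ] is 2-connected,
-- and there are no edges between distinct parts (so the G[Wᵢ] are exactly the
-- connected components of G - U).
DisjointUnionOf2Connected : ∀ {n} → Graph n → Subset n → ℕ → Set
DisjointUnionOf2Connected {n} G U s =
  ∃ λ (W : Fin s → Subset n) →
      (∀ v → (v ∉ U) → ∃ λ i → v ∈ W i)
    × (∀ i v → v ∈ W i → v ∉ U)
    × (∀ i j v → i ≢ j → v ∈ W i → ¬ (v ∈ W j))
    × (∀ i j u v → i ≢ j → u ∈ W i → v ∈ W j → adj G u v ≡ false)
    × (∀ i → TwoConnected G (W i))

-- Maintain a partition of G − U into s nonempty classes with no edges between them and
-- |U| ≤ s − 1, starting from U = ∅ and a single class. While some class W is not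
-- 2-connected, W is disconnected or has a cut vertex x; splitting W (after moving x into U)
-- raises s by one and |U| by at most one. A vertex v of a class W has all its neighbours in
-- W ∪ U, so |W| + |U| > deg v ≥ n/k + k; as |U| < k, every class has more than n/k vertices
-- (and at least 3). Since the classes are disjoint, s · n/k < n, i.e. s < k, so the
-- splitting stops after fewer than n steps.

module Submission where

open import Defs hiding (sym)
import Data.Nat
open import Data.Nat as ℕ using (ℕ; zero; suc; z≤n; s≤s)
import Data.Nat.Properties as ℕ
open import Data.Nat.ListAction using (sum)
import Data.Nat.Coprimality as Coprime
open import Data.Integer as ℤ using (+≤+; +<+)
import Data.Integer.Properties as ℤ
open import Data.Rational as ℚ
  using (ℚ; _≤_; _<_; _+_; _*_; mkℚ; 0ℚ; 1ℚ; 1/_; *≤*; *<*; NonZero; NonNegative; >-nonZero)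
open import Data.Rational.Properties
  using ( normalize-coprime; ≤-trans; <-≤-trans; ≤-<-trans; <-irrefl; ≰⇒>; module ≤-Reasoning
        ; +-mono-<; +-monoʳ-<; +-monoˡ-≤; *-comm; *-assoc; *-identityˡ; *-identityʳ; *-inverseˡ
        ; *-distribʳ-+; *-cancelʳ-≤-pos; *-cancelʳ-<-nonNeg )
open import Data.Bool using (Bool; true; false; if_then_else_)
import Data.Bool as Bool
open import Data.Bool.Properties using (¬-not)
open import Data.Fin using (Fin; zero; suc)
import Data.Fin.Properties as Fin
open import Data.Fin.Subset
  using (Subset; ∣_∣; inside; outside; _∈_; _∉_; _⊆_; _⊂_; _⊃_; _∩_; _∪_; ∁; ⁅_⁆; ⊥; Nonempty; Empty)
open import Data.Fin.Subset.Properties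
  using ( _∈?_; nonempty?; Empty-unique; ∉⊥; ∣⊥∣≡0; ∣p∣≤n; ∣⁅x⁆∣≡1; x∈⁅x⁆; x∈⁅y⁆⇒x≡y; x≢y⇒x∉⁅y⁆
        ; ⊆-antisym; p⊆q⇒∣p∣≤∣q∣; p⊂q⇒∣p∣<∣q∣; x∈∁p⇒x∉p; x∉p⇒x∈∁p
        ; x∈p∩q⁺; x∈p∩q⁻; x∈p∪q⁺; x∈p∪q⁻ )
open import Data.Fin.Subset.Induction using (⊃-wellFounded)
import Data.List as List
open import Data.List.Properties using (map-tabulate)
open import Data.Vec using (_∷_; []; tabulate; lookup)
open import Data.Vec.Properties using ([]=⇒lookup; lookup⇒[]=; lookup∘tabulate)
open import Data.Product using (_×_; ∃; _,_; proj₁; proj₂; uncurry)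
open import Data.Sum as Sum using (_⊎_; inj₁; inj₂)
open import Function using (_∘_; id)
open import Induction.WellFounded using (Acc; acc)
open import Relation.Binary.PropositionalEquality
  using (_≡_; _≢_; refl; sym; trans; cong; subst; subst₂; module ≡-Reasoning)
open import Relation.Nullary using (yes; no; contradiction; ¬?; _×-dec_)
open import Relation.Nullary.Decidable using (decidable-stable)
open import Algebra.Properties.Monoid.Sum ℕ.+-0-monoid using (sum-syntax)

∣p∪q∣+∣p∩q∣≡∣p∣+∣q∣ : ∀ {n} (p q : Subset n) → ∣ p ∪ q ∣ ℕ.+ ∣ p ∩ q ∣ ≡ ∣ p ∣ ℕ.+ ∣ q ∣
∣p∪q∣+∣p∩q∣≡∣p∣+∣q∣ []            []            = refl
∣p∪q∣+∣p∩q∣≡∣p∣+∣q∣ (outside ∷ p) (outside ∷ q) = ∣p∪q∣+∣p∩q∣≡∣p∣+∣q∣ p q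
∣p∪q∣+∣p∩q∣≡∣p∣+∣q∣ (inside  ∷ p) (outside ∷ q) = cong suc (∣p∪q∣+∣p∩q∣≡∣p∣+∣q∣ p q)
∣p∪q∣+∣p∩q∣≡∣p∣+∣q∣ (outside ∷ p) (inside  ∷ q) =
  trans (cong suc (∣p∪q∣+∣p∩q∣≡∣p∣+∣q∣ p q)) (sym (ℕ.+-suc ∣ p ∣ ∣ q ∣))
∣p∪q∣+∣p∩q∣≡∣p∣+∣q∣ (inside  ∷ p) (inside  ∷ q) = cong suc (begin
  ∣ p ∪ q ∣ ℕ.+ suc ∣ p ∩ q ∣    ≡⟨ ℕ.+-suc ∣ p ∪ q ∣ ∣ p ∩ q ∣ ⟩
  suc (∣ p ∪ q ∣ ℕ.+ ∣ p ∩ q ∣)  ≡⟨ cong suc (∣p∪q∣+∣p∩q∣≡∣p∣+∣q∣ p q) ⟩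
  suc (∣ p ∣ ℕ.+ ∣ q ∣)          ≡˘⟨ ℕ.+-suc ∣ p ∣ ∣ q ∣ ⟩
  ∣ p ∣ ℕ.+ suc ∣ q ∣            ∎)
  where open ≡-Reasoning

∣p∪q∣≤∣p∣+∣q∣ : ∀ {n} (p q : Subset n) → ∣ p ∪ q ∣ ℕ.≤ ∣ p ∣ ℕ.+ ∣ q ∣
∣p∪q∣≤∣p∣+∣q∣ p q = ℕ.≤-trans (ℕ.m≤m+n ∣ p ∪ q ∣ ∣ p ∩ q ∣) (ℕ.≤-reflexive (∣p∪q∣+∣p∩q∣≡∣p∣+∣q∣ p q))

∣p∪⁅x⁆∣≤1+∣p∣ : ∀ {n} (p : Subset n) (x : Fin n) → ∣ p ∪ ⁅ x ⁆ ∣ ℕ.≤ suc ∣ p ∣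
∣p∪⁅x⁆∣≤1+∣p∣ p x = begin
  ∣ p ∪ ⁅ x ⁆ ∣          ≤⟨ ∣p∪q∣≤∣p∣+∣q∣ p ⁅ x ⁆ ⟩
  ∣ p ∣ ℕ.+ ∣ ⁅ x ⁆ ∣    ≡⟨ cong (∣ p ∣ ℕ.+_) (∣⁅x⁆∣≡1 x) ⟩
  ∣ p ∣ ℕ.+ 1           ≡⟨ ℕ.+-comm ∣ p ∣ 1 ⟩
  suc ∣ p ∣             ∎
  where open ℕ.≤-Reasoning

∣p∣≤1+∣p∩∁⁅x⁆∣ : ∀ {n} (p : Subset n) (x : Fin n) → ∣ p ∣ ℕ.≤ suc ∣ p ∩ ∁ ⁅ x ⁆ ∣
∣p∣≤1+∣p∩∁⁅x⁆∣ p x = ℕ.≤-trans (p⊆q⇒∣p∣≤∣q∣ p⊆p-x∪x) (∣p∪⁅x⁆∣≤1+∣p∣ (p ∩ ∁ ⁅ x ⁆) x)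
  where
  p⊆p-x∪x : p ⊆ p ∩ ∁ ⁅ x ⁆ ∪ ⁅ x ⁆
  p⊆p-x∪x {y} y∈p with y Fin.≟ x
  ... | yes refl = x∈p∪q⁺ (inj₂ (x∈⁅x⁆ x))
  ... | no  y≢x  = x∈p∪q⁺ (inj₁ (x∈p∩q⁺ (y∈p , x∉p⇒x∈∁p (x≢y⇒x∉⁅y⁆ y≢x))))

∣p∣>0⇒Nonempty : ∀ {n} (p : Subset n) → 0 ℕ.< ∣ p ∣ → Nonempty p
∣p∣>0⇒Nonempty {n} p ∣p∣>0 with nonempty? p
... | yes p≢∅ = p≢∅
... | no  p≡∅ = contradiction (trans (cong ∣_∣ (Empty-unique p≡∅)) (∣⊥∣≡0 n)) (ℕ.>⇒≢ ∣p∣>0)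

Disjoint : ∀ {n} → Subset n → Subset n → Set
Disjoint p q = ∀ {x} → x ∈ p → x ∉ q

Disjoint⇒∣p∪q∣≡∣p∣+∣q∣ : ∀ {n} (p q : Subset n) → Disjoint p q → ∣ p ∪ q ∣ ≡ ∣ p ∣ ℕ.+ ∣ q ∣
Disjoint⇒∣p∪q∣≡∣p∣+∣q∣ {n} p q p#q = begin
  ∣ p ∪ q ∣                    ≡˘⟨ ℕ.+-identityʳ _ ⟩
  ∣ p ∪ q ∣ ℕ.+ 0              ≡˘⟨ cong (∣ p ∪ q ∣ ℕ.+_) (∣⊥∣≡0 n) ⟩
  ∣ p ∪ q ∣ ℕ.+ ∣ ⊥ {n} ∣      ≡˘⟨ cong (λ r → ∣ p ∪ q ∣ ℕ.+ ∣ r ∣) (Empty-unique p∩q-empty) ⟩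
  ∣ p ∪ q ∣ ℕ.+ ∣ p ∩ q ∣      ≡⟨ ∣p∪q∣+∣p∩q∣≡∣p∣+∣q∣ p q ⟩
  ∣ p ∣ ℕ.+ ∣ q ∣              ∎
  where
  open ≡-Reasoning
  p∩q-empty : Empty (p ∩ q)
  p∩q-empty (x , x∈p∩q) = uncurry p#q (x∈p∩q⁻ p q x∈p∩q)

∑∣disjoint∣≤n : ∀ {n s} (W : Fin s → Subset n) → (∀ {i j} → i ≢ j → Disjoint (W i) (W j)) →
                ∑[ i < s ] ∣ W i ∣ ℕ.≤ n
∑∣disjoint∣≤n {n} W W#W = ℕ.≤-trans (ℕ.m≤m+n _ ∣ ⊥ {n} ∣) (∑+∣p∣≤n W ⊥ (λ x∈⊥ → contradiction x∈⊥ ∉⊥) W#W)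
  where
  ∑+∣p∣≤n : ∀ {s} (W : Fin s → Subset n) (p : Subset n) → (∀ {i} → Disjoint p (W i)) →
            (∀ {i j} → i ≢ j → Disjoint (W i) (W j)) → ∑[ i < s ] ∣ W i ∣ ℕ.+ ∣ p ∣ ℕ.≤ n
  ∑+∣p∣≤n {zero}  W p _ _ = ∣p∣≤n p
  ∑+∣p∣≤n {suc s} W p p#W W#W = begin
    (∣ W₀ ∣ ℕ.+ ∑W₊) ℕ.+ ∣ p ∣   ≡⟨ cong (ℕ._+ ∣ p ∣) (ℕ.+-comm ∣ W₀ ∣ ∑W₊) ⟩
    (∑W₊ ℕ.+ ∣ W₀ ∣) ℕ.+ ∣ p ∣   ≡⟨ ℕ.+-assoc ∑W₊ ∣ W₀ ∣ ∣ p ∣ ⟩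
    ∑W₊ ℕ.+ (∣ W₀ ∣ ℕ.+ ∣ p ∣)   ≡˘⟨ cong (∑W₊ ℕ.+_) (Disjoint⇒∣p∪q∣≡∣p∣+∣q∣ W₀ p (λ x∈W₀ x∈p → p#W x∈p x∈W₀)) ⟩
    ∑W₊ ℕ.+ ∣ W₀ ∪ p ∣           ≤⟨ ∑+∣p∣≤n (W ∘ suc) (W₀ ∪ p) W₀∪p#W₊ (λ i≢j → W#W (i≢j ∘ Fin.suc-injective)) ⟩
    n                            ∎
    where
    open ℕ.≤-Reasoning
    W₀ = W zero
    ∑W₊ = ∑[ i < s ] ∣ W (suc i) ∣
    W₀∪p#W₊ : ∀ {i} → Disjoint (W₀ ∪ p) (W (suc i))
    W₀∪p#W₊ x∈W₀∪p with x∈p∪q⁻ W₀ p x∈W₀∪p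
    ... | inj₁ x∈W₀ = W#W (λ ()) x∈W₀
    ... | inj₂ x∈p  = p#W x∈p

∈-tabulate⁺ : ∀ {n} {f : Fin n → Bool} {x} → f x ≡ true → x ∈ tabulate f
∈-tabulate⁺ {f = f} {x} fx≡true = lookup⇒[]= x (tabulate f) (trans (lookup∘tabulate f x) fx≡true)

∈-tabulate⁻ : ∀ {n} {f : Fin n → Bool} {x} → x ∈ tabulate f → f x ≡ true
∈-tabulate⁻ {f = f} {x} x∈f = trans (sym (lookup∘tabulate f x)) ([]=⇒lookup x∈f)

_⁻¹_ : ∀ {m n} → (Fin m → Fin n) → Subset n → Subset m
f ⁻¹ p = tabulate (λ x → lookup p (f x))

∈-⁻¹⁺ : ∀ {m n} {f : Fin m → Fin n} {p x} → f x ∈ p → x ∈ f ⁻¹ p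
∈-⁻¹⁺ fx∈p = ∈-tabulate⁺ ([]=⇒lookup fx∈p)

∈-⁻¹⁻ : ∀ {m n} {f : Fin m → Fin n} {p x} → x ∈ f ⁻¹ p → f x ∈ p
∈-⁻¹⁻ {f = f} {p} {x} x∈f⁻¹p = lookup⇒[]= (f x) p (∈-tabulate⁻ x∈f⁻¹p)

sum-indicator≡∣tabulate∣ : ∀ {n} (f : Fin n → Bool) →
  sum (List.map (λ x → if f x then 1 else 0) (List.allFin n)) ≡ ∣ tabulate f ∣
sum-indicator≡∣tabulate∣ {n} f = trans (cong sum (map-tabulate {n = n} id (λ x → if f x then 1 else 0))) (go f)
  where
  go : ∀ {n} (f : Fin n → Bool) → sum (List.tabulate (λ x → if f x then 1 else 0)) ≡ ∣ tabulate f ∣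
  go {zero}  f = refl
  go {suc n} f with f zero
  ... | true  = cong suc (go (f ∘ suc))
  ... | false = go (f ∘ suc)

all⊎any : ∀ {n} {P Q : Fin n → Set} → (∀ i → P i ⊎ Q i) → (∀ i → P i) ⊎ ∃ Q
all⊎any {zero}  _ = inj₁ λ ()
all⊎any {suc n} P⊎Q with P⊎Q zero | all⊎any (P⊎Q ∘ suc)
... | inj₂ q | _            = inj₂ (zero , q)
... | inj₁ _ | inj₂ (i , q) = inj₂ (suc i , q)
... | inj₁ p | inj₁ ps      = inj₁ (Fin.∀-cons p ps)

private
  ℕ→ℚ≡mkℚ : ∀ m → ℕ→ℚ m ≡ mkℚ (ℤ.+ m) 0 (Coprime.sym (Coprime.1-coprimeTo m))
  ℕ→ℚ≡mkℚ m = normalize-coprime (Coprime.sym (Coprime.1-coprimeTo m))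

ℕ→ℚ-homo-+ : ∀ a b → ℕ→ℚ (a ℕ.+ b) ≡ ℕ→ℚ a + ℕ→ℚ b
ℕ→ℚ-homo-+ a b rewrite ℕ→ℚ≡mkℚ a | ℕ→ℚ≡mkℚ b | ℤ.*-identityʳ (ℤ.+ a) | ℤ.*-identityʳ (ℤ.+ b) = refl

ℕ→ℚ-mono-≤ : ∀ {a b} → a ℕ.≤ b → ℕ→ℚ a ≤ ℕ→ℚ b
ℕ→ℚ-mono-≤ {a} {b} a≤b rewrite ℕ→ℚ≡mkℚ a | ℕ→ℚ≡mkℚ b = *≤* (ℤ.*-monoʳ-≤-nonNeg (ℤ.+ 1) (+≤+ a≤b))

ℕ→ℚ-mono-< : ∀ {a b} → a ℕ.< b → ℕ→ℚ a < ℕ→ℚ b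
ℕ→ℚ-mono-< {a} {b} a<b rewrite ℕ→ℚ≡mkℚ a | ℕ→ℚ≡mkℚ b =
  *<* (subst₂ ℤ._<_ (sym (ℤ.*-identityʳ (ℤ.+ a))) (sym (ℤ.*-identityʳ (ℤ.+ b))) (+<+ a<b))

ℕ→ℚ-cancel-< : ∀ {a b} → ℕ→ℚ a < ℕ→ℚ b → a ℕ.< b
ℕ→ℚ-cancel-< {a} {b} a<b rewrite ℕ→ℚ≡mkℚ a | ℕ→ℚ≡mkℚ b with a<b
... | *<* a*1<b*1 rewrite ℤ.*-identityʳ (ℤ.+ a) | ℤ.*-identityʳ (ℤ.+ b) with a*1<b*1
... | +<+ a<b = a<b

2≤k⇒0<k : ∀ {k} → ℕ→ℚ 2 ≤ k → 0ℚ < k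
2≤k⇒0<k = <-≤-trans (*<* (+<+ (s≤s z≤n)))

p/ₖk*k≡p : ∀ p k (k≥2 : ℕ→ℚ 2 ≤ k) → (p /ₖ k ⟨ k≥2 ⟩) * k ≡ p
p/ₖk*k≡p p k k≥2 = begin
  p * 1/ k * k    ≡⟨ *-assoc p (1/ k) k ⟩
  p * (1/ k * k)  ≡⟨ cong (p *_) (*-inverseˡ k) ⟩
  p * 1ℚ          ≡⟨ *-identityʳ p ⟩
  p               ∎
  where
  open ≡-Reasoning
  instance
    k≢0 : NonZero k
    k≢0 = >-nonZero (2≤k⇒0<k k≥2)

[1+s]*q<∑ : ∀ {s q} (m : Fin (suc s) → ℕ) → (∀ i → q < ℕ→ℚ (m i)) →
            ℕ→ℚ (suc s) * q < ℕ→ℚ (∑[ i < suc s ] m i)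
[1+s]*q<∑ {zero} {q} m q<m = begin-strict
  1ℚ * q               ≡⟨ *-identityˡ q ⟩
  q                    <⟨ q<m zero ⟩
  ℕ→ℚ (m zero)         ≡˘⟨ cong ℕ→ℚ (ℕ.+-identityʳ (m zero)) ⟩
  ℕ→ℚ (m zero ℕ.+ 0)   ∎
  where open ≤-Reasoning
[1+s]*q<∑ {suc s} {q} m q<m = begin-strict
  ℕ→ℚ (1 ℕ.+ suc s) * q          ≡⟨ cong (_* q) (ℕ→ℚ-homo-+ 1 (suc s)) ⟩
  (1ℚ + ℕ→ℚ (suc s)) * q         ≡⟨ *-distribʳ-+ q 1ℚ (ℕ→ℚ (suc s)) ⟩
  1ℚ * q + ℕ→ℚ (suc s) * q       ≡⟨ cong (_+ ℕ→ℚ (suc s) * q) (*-identityˡ q) ⟩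
  q + ℕ→ℚ (suc s) * q            <⟨ +-mono-< (q<m zero) ([1+s]*q<∑ (m ∘ suc) (q<m ∘ suc)) ⟩
  ℕ→ℚ (m zero) + ℕ→ℚ ∑m₊         ≡˘⟨ ℕ→ℚ-homo-+ (m zero) ∑m₊ ⟩
  ℕ→ℚ (∑[ i < suc (suc s) ] m i) ∎
  where
  open ≤-Reasoning
  ∑m₊ = ∑[ i < suc s ] m (suc i)

module SizeFromDegree {d k : ℚ} {D m t : ℕ}
                      (d+k≤D : d + k ≤ ℕ→ℚ D) (t<k : ℕ→ℚ t < k) (D<m+t : D ℕ.< m ℕ.+ t) where

  d<m : d < ℕ→ℚ m
  d<m = ≰⇒> λ m≤d → <-irrefl refl (begin-strict
    ℕ→ℚ (m ℕ.+ t)      ≡⟨ ℕ→ℚ-homo-+ m t ⟩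
    ℕ→ℚ m + ℕ→ℚ t      <⟨ +-monoʳ-< (ℕ→ℚ m) t<k ⟩
    ℕ→ℚ m + k          ≤⟨ +-monoˡ-≤ k m≤d ⟩
    d + k              ≤⟨ d+k≤D ⟩
    ℕ→ℚ D              <⟨ ℕ→ℚ-mono-< D<m+t ⟩
    ℕ→ℚ (m ℕ.+ t)      ∎)
    where open ≤-Reasoning

  3≤m : 1ℚ ≤ d → 3 ℕ.≤ m
  3≤m 1≤d = ℕ.+-cancelʳ-≤ t 3 m (ℕ.≤-trans (s≤s 2+t≤D) D<m+t)
    where
    2+t≤D : 2 ℕ.+ t ℕ.≤ D
    2+t≤D = ℕ→ℚ-cancel-< (begin-strict
      ℕ→ℚ (1 ℕ.+ t)   ≡⟨ ℕ→ℚ-homo-+ 1 t ⟩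
      1ℚ + ℕ→ℚ t      <⟨ +-monoʳ-< 1ℚ t<k ⟩
      1ℚ + k          ≤⟨ +-monoˡ-≤ k 1≤d ⟩
      d + k           ≤⟨ d+k≤D ⟩
      ℕ→ℚ D           ∎)
      where open ≤-Reasoning

module _ {n s : ℕ} where

  -- Opaque so that U, c and i can be inferred from class U c i; it is only used through ∈-class⁺/⁻.
  opaque
    class : Subset n → (Fin n → Fin s) → Fin s → Subset n
    class U c i = ∁ U ∩ c ⁻¹ ⁅ i ⁆

    ∈-class⁺ : ∀ {U c i v} → v ∉ U → c v ≡ i → v ∈ class U c i
    ∈-class⁺ {i = i} v∉U refl = x∈p∩q⁺ (x∉p⇒x∈∁p v∉U , ∈-⁻¹⁺ (x∈⁅x⁆ i))

    ∈-class⁻ : ∀ {U c i v} → v ∈ class U c i → v ∉ U × c v ≡ i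
    ∈-class⁻ {U} {i = i} v∈class with x∈p∩q⁻ (∁ U) _ v∈class
    ... | v∈∁U , v∈c⁻¹i = x∈∁p⇒x∉p v∈∁U , x∈⁅y⁆⇒x≡y i (∈-⁻¹⁻ v∈c⁻¹i)

  classes-disjoint : ∀ {U c i j} → i ≢ j → Disjoint (class U c i) (class U c j)
  classes-disjoint i≢j v∈i v∈j = i≢j (trans (sym (proj₂ (∈-class⁻ v∈i))) (proj₂ (∈-class⁻ v∈j)))

  class-∩-∁ : ∀ U X (c : Fin n → Fin s) i → class U c i ∩ ∁ X ≡ class (U ∪ X) c i
  class-∩-∁ U X c i = ⊆-antisym ∩∁⊆ ⊆∩∁
    where
    ∩∁⊆ : class U c i ∩ ∁ X ⊆ class (U ∪ X) c i
    ∩∁⊆ v∈ with x∈p∩q⁻ _ (∁ X) v∈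
    ... | v∈class , v∈∁X with ∈-class⁻ v∈class
    ... | v∉U , cv≡i = ∈-class⁺ (λ v∈U∪X → Sum.[ v∉U , x∈∁p⇒x∉p v∈∁X ] (x∈p∪q⁻ U X v∈U∪X)) cv≡i
    ⊆∩∁ : class (U ∪ X) c i ⊆ class U c i ∩ ∁ X
    ⊆∩∁ v∈ with ∈-class⁻ v∈
    ... | v∉U∪X , cv≡i = x∈p∩q⁺ (∈-class⁺ (v∉U∪X ∘ x∈p∪q⁺ ∘ inj₁) cv≡i , x∉p⇒x∈∁p (v∉U∪X ∘ x∈p∪q⁺ ∘ inj₂))

module _ {n} (G : Graph n) where

  walk-source : ∀ {W u v} → Walk G W u v → u ∈ W
  walk-source (here u∈W)     = u∈W
  walk-source (step u∈W _ _) = u∈W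

  _++ʷ_ : ∀ {W u v w} → Walk G W u v → Walk G W v w → Walk G W u w
  here _       ++ʷ q = q
  step u∈W e p ++ʷ q = step u∈W e (p ++ʷ q)

  reverseʷ : ∀ {W u v} → Walk G W u v → Walk G W v u
  reverseʷ (here v∈W)                 = here v∈W
  reverseʷ (step {u} {w} u∈W e p) = reverseʷ p ++ʷ step (walk-source p) (trans (Graph.sym G w u) e) (here u∈W)

  record Separation (S : Subset n) : Set where
    field
      side           : Subset n
      side⊆S         : side ⊆ S
      side-inhabited : Nonempty side
      rest-inhabited : ∃ λ a → a ∈ S × a ∉ side
      edge-closed    : ∀ {u w} → u ∈ side → w ∈ S → adj G u w ≡ true → w ∈ side

  private
    -- Search from v inside S: R only grows, and ⊃ is well-founded on subsets.
    grow : ∀ {S v} (R : Subset n) → Acc _⊃_ R → R ⊆ S → v ∈ R →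
           (∀ {u} → u ∈ R → Walk G S u v) → Connected G S ⊎ Separation S
    grow {S} {v} R (acc larger) R⊆S v∈R walk
      with Fin.any? (λ u → Fin.any? (λ w →
             (u ∈? R) ×-dec (w ∈? S) ×-dec ¬? (w ∈? R) ×-dec (adj G u w Bool.≟ true)))
    ... | yes (u , w , u∈R , w∈S , w∉R , e) =
      grow (R ∪ ⁅ w ⁆) (larger R⊂R∪w) R∪w⊆S (x∈p∪q⁺ (inj₁ v∈R)) walk′
      where
      R⊂R∪w : R ⊂ R ∪ ⁅ w ⁆
      R⊂R∪w = (λ x∈R → x∈p∪q⁺ (inj₁ x∈R)) , w , x∈p∪q⁺ (inj₂ (x∈⁅x⁆ w)) , w∉R
      R∪w⊆S : R ∪ ⁅ w ⁆ ⊆ S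
      R∪w⊆S x∈ with x∈p∪q⁻ R ⁅ w ⁆ x∈
      ... | inj₁ x∈R = R⊆S x∈R
      ... | inj₂ x∈w rewrite x∈⁅y⁆⇒x≡y w x∈w = w∈S
      walk′ : ∀ {x} → x ∈ R ∪ ⁅ w ⁆ → Walk G S x v
      walk′ x∈ with x∈p∪q⁻ R ⁅ w ⁆ x∈
      ... | inj₁ x∈R = walk x∈R
      ... | inj₂ x∈w rewrite x∈⁅y⁆⇒x≡y w x∈w = step w∈S (trans (Graph.sym G w u) e) (walk u∈R)
    ... | no no-exit with Fin.any? (λ a → (a ∈? S) ×-dec ¬? (a ∈? R))
    ...   | yes (a , a∈S , a∉R) = inj₂ record
      { side = R ; side⊆S = R⊆S ; side-inhabited = v , v∈R ; rest-inhabited = a , a∈S , a∉R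
      ; edge-closed = λ {u} {w} u∈R w∈S e →
          decidable-stable (w ∈? R) (λ w∉R → no-exit (u , w , u∈R , w∈S , w∉R , e)) }
    ...   | no S⊈R = inj₁ ((v , R⊆S v∈R) , λ x y x∈S y∈S → walk (S⊆R x∈S) ++ʷ reverseʷ (walk (S⊆R y∈S)))
      where
      S⊆R : S ⊆ R
      S⊆R {x} x∈S = decidable-stable (x ∈? R) (λ x∉R → S⊈R (x , x∈S , x∉R))

  connected⊎separation : ∀ {S} → Nonempty S → Connected G S ⊎ Separation S
  connected⊎separation {S} (v , v∈S) = grow ⁅ v ⁆ (⊃-wellFounded _) v⊆S (x∈⁅x⁆ v) walk
    where
    v⊆S : ⁅ v ⁆ ⊆ S
    v⊆S x∈v rewrite x∈⁅y⁆⇒x≡y v x∈v = v∈S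
    walk : ∀ {u} → u ∈ ⁅ v ⁆ → Walk G S u v
    walk u∈v rewrite x∈⁅y⁆⇒x≡y v u∈v = here v∈S

  data Separable (W : Subset n) : Set where
    disconnected : Separation W → Separable W
    cut-vertex   : ∀ {x} → x ∈ W → Separation (W ∩ ∁ ⁅ x ⁆) → Separable W

  twoConnected⊎separable : ∀ {W} → 3 ℕ.≤ ∣ W ∣ → TwoConnected G W ⊎ Separable W
  twoConnected⊎separable {W} 3≤∣W∣ with connected⊎separation (∣p∣>0⇒Nonempty W (ℕ.<-≤-trans (s≤s z≤n) 3≤∣W∣))
  ... | inj₂ sep = inj₂ (disconnected sep)
  ... | inj₁ W-connected with all⊎any delete
    where
    delete : ∀ x → (x ∈ W → Connected G (W ∩ ∁ ⁅ x ⁆)) ⊎ (x ∈ W × Separation (W ∩ ∁ ⁅ x ⁆))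
    delete x with x ∈? W
    ... | no  x∉W = inj₁ λ x∈W → contradiction x∈W x∉W
    ... | yes x∈W = Sum.map (λ connected _ → connected) (x∈W ,_) (connected⊎separation nonempty)
      where
      nonempty : Nonempty (W ∩ ∁ ⁅ x ⁆)
      nonempty = ∣p∣>0⇒Nonempty _ (ℕ.s≤s⁻¹ (ℕ.≤-trans (s≤s (s≤s z≤n)) (ℕ.≤-trans 3≤∣W∣ (∣p∣≤1+∣p∩∁⁅x⁆∣ W x))))
  ... | inj₁ all-connected   = inj₁ (3≤∣W∣ , W-connected , all-connected)
  ... | inj₂ (x , x∈W , sep) = inj₂ (cut-vertex x∈W sep)

  neighbours : Fin n → Subset n
  neighbours v = tabulate (adj G v)

  deg≡∣neighbours∣ : ∀ v → deg G v ≡ ∣ neighbours v ∣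
  deg≡∣neighbours∣ v = sum-indicator≡∣tabulate∣ (adj G v)

  record Decomposition (U : Subset n) (s : ℕ) : Set where
    field
      colour         : Fin n → Fin s
      colour-edge    : ∀ {u v} → u ∉ U → v ∉ U → adj G u v ≡ true → colour u ≡ colour v
      class-nonempty : ∀ i → Nonempty (class U colour i)

  open Decomposition public

  deg<∣class∣+∣U∣ : ∀ {U s} (D : Decomposition U s) {v} → v ∉ U →
                    deg G v ℕ.< ∣ class U (colour D) (colour D v) ∣ ℕ.+ ∣ U ∣
  deg<∣class∣+∣U∣ {U} D {v} v∉U = begin-strict
    deg G v                        ≡⟨ deg≡∣neighbours∣ v ⟩
    ∣ neighbours v ∣               <⟨ p⊂q⇒∣p∣<∣q∣ N⊂W∪U ⟩
    ∣ W ∪ U ∣                      ≤⟨ ∣p∪q∣≤∣p∣+∣q∣ W U ⟩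
    ∣ W ∣ ℕ.+ ∣ U ∣                ∎
    where
    open ℕ.≤-Reasoning
    W = class U (colour D) (colour D v)
    N⊆W∪U : neighbours v ⊆ W ∪ U
    N⊆W∪U {w} w∈N with w ∈? U
    ... | yes w∈U = x∈p∪q⁺ (inj₂ w∈U)
    ... | no  w∉U = x∈p∪q⁺ (inj₁ (∈-class⁺ w∉U (sym (colour-edge D v∉U w∉U (∈-tabulate⁻ w∈N)))))
    N⊂W∪U : neighbours v ⊂ W ∪ U
    N⊂W∪U = N⊆W∪U , v , x∈p∪q⁺ (inj₁ (∈-class⁺ v∉U refl)) ,
            λ v∈N → contradiction (trans (sym (∈-tabulate⁻ v∈N)) (irrefl G v)) λ ()

  decomposition⇒disjointUnion : ∀ {U s} (D : Decomposition U s) →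
    (∀ i → TwoConnected G (class U (colour D) i)) → DisjointUnionOf2Connected G U s
  decomposition⇒disjointUnion D twoConnected =
    class _ (colour D) ,
    (λ v v∉U → colour D v , ∈-class⁺ v∉U refl) ,
    (λ i v v∈i → proj₁ (∈-class⁻ v∈i)) ,
    (λ i j v i≢j → classes-disjoint i≢j) ,
    (λ i j u v i≢j u∈i v∈j → ¬-not λ e → i≢j (begin
      i              ≡˘⟨ proj₂ (∈-class⁻ u∈i) ⟩
      colour D u     ≡⟨ colour-edge D (proj₁ (∈-class⁻ u∈i)) (proj₁ (∈-class⁻ v∈j)) e ⟩
      colour D v     ≡⟨ proj₂ (∈-class⁻ v∈j) ⟩
      j              ∎)) ,
    twoConnected
    where open ≡-Reasoning

  refine : ∀ {U U′ s} (D : Decomposition U s) (i : Fin s) → U ⊆ U′ →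
           (∀ {v} → v ∈ U′ → v ∉ U → colour D v ≡ i) →
           Separation (class U′ (colour D) i) → Decomposition U′ (suc s)
  refine {U} {U′} D i U⊆U′ U′-U⊆i sep = record
    { colour = colour′ ; colour-edge = colour′-edge ; class-nonempty = class′-nonempty }
    where
    open Separation sep
    c = colour D
    colour′ : Fin _ → Fin (suc _)
    colour′ v with v ∈? side
    ... | yes _ = zero
    ... | no  _ = suc (c v)

    on-side : ∀ {v} → v ∈ side → colour′ v ≡ zero
    on-side {v} v∈B with v ∈? side
    ... | yes _   = refl
    ... | no  v∉B = contradiction v∈B v∉B

    off-side : ∀ {v} → v ∉ side → colour′ v ≡ suc (c v)
    off-side {v} v∉B with v ∈? side
    ... | yes v∈B = contradiction v∈B v∉B
    ... | no  _   = refl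

    crossing : ∀ {u v} → u ∈ side → v ∉ side → v ∉ U′ → adj G u v ≡ true → c u ≢ c v
    crossing u∈B v∉B v∉U′ e cu≡cv =
      v∉B (edge-closed u∈B (∈-class⁺ v∉U′ (trans (sym cu≡cv) (proj₂ (∈-class⁻ (side⊆S u∈B))))) e)

    colour′-edge : ∀ {u v} → u ∉ U′ → v ∉ U′ → adj G u v ≡ true → colour′ u ≡ colour′ v
    colour′-edge {u} {v} u∉U′ v∉U′ e with u ∈? side | v ∈? side | colour-edge D (u∉U′ ∘ U⊆U′) (v∉U′ ∘ U⊆U′) e
    ... | yes _   | yes _   | _     = refl
    ... | no  _   | no  _   | cu≡cv = cong suc cu≡cv
    ... | yes u∈B | no  v∉B | cu≡cv = contradiction cu≡cv (crossing u∈B v∉B v∉U′ e)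
    ... | no  u∉B | yes v∈B | cu≡cv = contradiction (sym cu≡cv) (crossing v∈B u∉B u∉U′ (trans (Graph.sym G v u) e))

    class′-nonempty : ∀ j → Nonempty (class U′ colour′ j)
    class′-nonempty zero with side-inhabited
    ... | b , b∈B = b , ∈-class⁺ (proj₁ (∈-class⁻ (side⊆S b∈B))) (on-side b∈B)
    class′-nonempty (suc j) with j Fin.≟ i
    ... | yes refl with rest-inhabited
    ...   | a , a∈S , a∉B =
      a , ∈-class⁺ (proj₁ (∈-class⁻ a∈S)) (trans (off-side a∉B) (cong suc (proj₂ (∈-class⁻ a∈S))))
    class′-nonempty (suc j) | no j≢i with class-nonempty D j
    ...   | w , w∈j = w , ∈-class⁺ w∉U′ (trans (off-side w∉B) (cong suc cw≡j))
      where
      w∉U = proj₁ (∈-class⁻ w∈j)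
      cw≡j = proj₂ (∈-class⁻ w∈j)
      w∉U′ : w ∉ U′
      w∉U′ w∈U′ = j≢i (trans (sym cw≡j) (U′-U⊆i w∈U′ w∉U))
      w∉B : w ∉ side
      w∉B w∈B = j≢i (trans (sym cw≡j) (proj₂ (∈-class⁻ (side⊆S w∈B))))

  single-class : Fin n → Decomposition ⊥ 1
  single-class v = record
    { colour = λ _ → zero ; colour-edge = λ _ _ _ → refl ; class-nonempty = λ { zero → v , ∈-class⁺ ∉⊥ refl } }

module _ {n} (k : ℚ) (k≥2 : ℕ→ℚ 2 ≤ k) (k≤n : k ≤ ℕ→ℚ n) (G : Graph n)
         (δ≥ : ∀ v → (ℕ→ℚ n /ₖ k ⟨ k≥2 ⟩) + k ≤ ℕ→ℚ (deg G v)) where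

  private
    d : ℚ
    d = ℕ→ℚ n /ₖ k ⟨ k≥2 ⟩

    1≤d : 1ℚ ≤ d
    1≤d = *-cancelʳ-≤-pos k {{ℚ.positive (2≤k⇒0<k k≥2)}} (begin
      1ℚ * k    ≡⟨ *-identityˡ k ⟩
      k         ≤⟨ k≤n ⟩
      ℕ→ℚ n     ≡˘⟨ p/ₖk*k≡p (ℕ→ℚ n) k k≥2 ⟩
      d * k     ∎)
      where open ≤-Reasoning

  record State (s : ℕ) : Set where
    field
      U             : Subset n
      decomposition : Decomposition G U s
      1+∣U∣≤s       : suc ∣ U ∣ ℕ.≤ s
      ∣U∣<k         : ℕ→ℚ ∣ U ∣ < k

  parts : ∀ {s} → State s → Fin s → Subset n
  parts st = class (State.U st) (colour (State.decomposition st))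

  part-size : ∀ {s} (st : State s) i → d < ℕ→ℚ ∣ parts st i ∣ × 3 ℕ.≤ ∣ parts st i ∣
  part-size st i with class-nonempty (State.decomposition st) i
  ... | v , v∈Wi with ∈-class⁻ v∈Wi
  ... | v∉U , refl = d<m , 3≤m 1≤d
    where
    open State st
    open SizeFromDegree {d} {k} {deg G v} {∣ parts st i ∣} {∣ U ∣}
           (δ≥ v) ∣U∣<k (deg<∣class∣+∣U∣ G decomposition v∉U)

  s<k : ∀ {s} → State s → ℕ→ℚ s < k
  s<k {zero}    st = contradiction (State.1+∣U∣≤s st) λ ()
  s<k {suc s′} st = *-cancelʳ-<-nonNeg d {{d≥0}} (begin-strict
    ℕ→ℚ (suc s′) * d                      <⟨ [1+s]*q<∑ (∣_∣ ∘ parts st) (proj₁ ∘ part-size st) ⟩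
    ℕ→ℚ (∑[ i < suc s′ ] ∣ parts st i ∣)   ≤⟨ ℕ→ℚ-mono-≤ (∑∣disjoint∣≤n (parts st) classes-disjoint) ⟩
    ℕ→ℚ n                                 ≡˘⟨ p/ₖk*k≡p (ℕ→ℚ n) k k≥2 ⟩
    d * k                                 ≡⟨ *-comm d k ⟩
    k * d                                 ∎)
    where
    open ≤-Reasoning
    d≥0 : NonNegative d
    d≥0 = ℚ.nonNegative (≤-trans (*≤* (+≤+ z≤n)) 1≤d)

  split : ∀ {s} (st : State s) (i : Fin s) → Separable G (parts st i) → State (suc s)
  split st i (disconnected sep) = record
    { U = U
    ; decomposition = refine G decomposition i id (λ v∈U v∉U → contradiction v∈U v∉U) sep
    ; 1+∣U∣≤s = ℕ.m≤n⇒m≤1+n 1+∣U∣≤s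
    ; ∣U∣<k = ∣U∣<k }
    where open State st
  split {s} st i (cut-vertex {x} x∈Wi sep) = record
    { U = U ∪ ⁅ x ⁆
    ; decomposition = refine G decomposition i (x∈p∪q⁺ ∘ inj₁) new-in-Wi
        (subst (Separation G) (class-∩-∁ U ⁅ x ⁆ c i) sep)
    ; 1+∣U∣≤s = s≤s ∣U∪x∣≤s
    ; ∣U∣<k = ≤-<-trans (ℕ→ℚ-mono-≤ ∣U∪x∣≤s) (s<k st) }
    where
    open State st
    c = colour decomposition
    ∣U∪x∣≤s : ∣ U ∪ ⁅ x ⁆ ∣ ℕ.≤ s
    ∣U∪x∣≤s = ℕ.≤-trans (∣p∪⁅x⁆∣≤1+∣p∣ U x) 1+∣U∣≤s
    new-in-Wi : ∀ {v} → v ∈ U ∪ ⁅ x ⁆ → v ∉ U → c v ≡ i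
    new-in-Wi v∈U∪x v∉U with x∈p∪q⁻ U ⁅ x ⁆ v∈U∪x
    ... | inj₁ v∈U = contradiction v∈U v∉U
    ... | inj₂ v∈x rewrite x∈⁅y⁆⇒x≡y x v∈x = proj₂ (∈-class⁻ x∈Wi)

  initial : Fin n → State 1
  initial v = record
    { U = ⊥
    ; decomposition = single-class G v
    ; 1+∣U∣≤s = ℕ.≤-reflexive (cong suc (∣⊥∣≡0 n))
    ; ∣U∣<k = subst (λ m → ℕ→ℚ m < k) (sym (∣⊥∣≡0 n)) (2≤k⇒0<k k≥2) }

  -- f bounds the number of splits still to come: s < k ≤ n in every state.
  decompose : ∀ {s} f → n ≡ s ℕ.+ f → State s →
              ∃ λ (s : ℕ) → (ℕ→ℚ s < k) × ∃ λ (U : Subset n) →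
                (suc ∣ U ∣ ℕ.≤ s) × DisjointUnionOf2Connected G U s
  decompose {s} zero n≡s+0 st =
    contradiction (trans n≡s+0 (ℕ.+-identityʳ s)) (ℕ.>⇒≢ (ℕ→ℚ-cancel-< (<-≤-trans (s<k st) k≤n)))
  decompose {s} (suc f) n≡s+1+f st with all⊎any (λ i → twoConnected⊎separable G (proj₂ (part-size st i)))
  ... | inj₁ twoConnected = s , s<k st , U , 1+∣U∣≤s , decomposition⇒disjointUnion G decomposition twoConnected
    where open State st
  ... | inj₂ (i , separable) = decompose f (trans n≡s+1+f (ℕ.+-suc s f)) (split st i separable)

lemma7 : (n : ℕ) → 1 Data.Nat.≤ n → (k : ℚ) → (k≥2 : ℕ→ℚ 2 ≤ k) → k ≤ ℕ→ℚ n →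
    (G : Graph n) →
    (∀ v → (ℕ→ℚ n /ₖ k ⟨ k≥2 ⟩) + k ≤ ℕ→ℚ (deg G v)) →
    ∃ λ (s : ℕ) → (ℕ→ℚ s < k) × ∃ λ (U : Subset n) →
      (suc ∣ U ∣ Data.Nat.≤ s) × DisjointUnionOf2Connected G U s
lemma7 zero    ()
lemma7 (suc n) _ k k≥2 k≤n G δ≥ = decompose k k≥2 k≤n G δ≥ n refl (initial k k≥2 k≤n G δ≥ zero)
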